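{- (i) If $G$ and $H$ are Naji graphs on the same vertex set $V$ with $\mathcal{B}(G)=\mathcal{B}(H)$, then $E(G)=E(H)$; thus a Naji graph is determined (in particular up to isomorphism) by its set of Naji solutions. (ii) However, there exist nonisomorphic Naji graphs on the same vertex set which have a Naji solution in common.
   Context: All graphs are finite and simple. For a graph $G$ and each ordered pair $(v,w)$ of distinct vertices there is a variable $\beta(v,w)$. The Naji equations of $G$ are: (a) for each edge $vw$, $\beta(v,w)+\beta(w,v)=1$; (b) if $v,w,x$ are distinct with $vw\in E(G)$ and $vx,wx\notin E(G)$, then $\beta(x,v)+\beta(x,w)=0$; (c) if $v,w,x$ are distinct with $vw,vx\in E(G)$ and $wx\notin E(G)$, then $\beta(v,w)+\beta(v,x)+\beta(w,x)+\beta(x,w)=1$. A Naji solution is a function $\beta$ from ordered pairs of distinct vertices to $GF(2)$ satisfying all these equations; $\mathcal{B}(G)$ is the set of Naji solutions, and $G$ is a Naji graph if $\mathcal{B}(G)\neq\varnothing$. -}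

module Defs where

open import Data.Nat using (ℕ)
open import Data.Fin using (Fin)
open import Data.Bool using (Bool; true; false; _xor_)
open import Data.Product using (Σ; ∃; _×_)
open import Relation.Binary.PropositionalEquality using (_≡_; _≢_)
open import Function.Bundles using (_⤖_; Bijection)

record Graph (n : ℕ) : Set where
  field
    adj   : Fin n → Fin n → Bool
    sym   : ∀ v w → adj v w ≡ adj w v
    irrefl : ∀ v → adj v v ≡ false
open Graph public

-- GF(2) is represented by Bool, with addition = xor, 0 = false, 1 = true.
-- An assignment β(v,w) for ordered pairs; values on the diagonal (v = w)
-- do not occur in any equation and are irrelevant.
Assignment : ℕ → Set
Assignment n = Fin n → Fin n → Bool

record IsNajiSolution {n : ℕ} (G : Graph n) (β : Assignment n) : Set where
  field
    eqA : ∀ v w → v ≢ w → adj G v w ≡ true →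
          (β v w xor β w v) ≡ true
    eqB : ∀ v w x → v ≢ w → v ≢ x → w ≢ x →
          adj G v w ≡ true → adj G v x ≡ false → adj G w x ≡ false →
          (β x v xor β x w) ≡ false
    eqC : ∀ v w x → v ≢ w → v ≢ x → w ≢ x →
          adj G v w ≡ true → adj G v x ≡ true → adj G w x ≡ false →
          (β v w xor β v x xor β w x xor β x w) ≡ true

IsNaji : ∀ {n} → Graph n → Set
IsNaji G = ∃ λ β → IsNajiSolution G β

-- B(G) = B(H): the same assignments are solutions.  (Since the diagonal
-- values are irrelevant, this is equality of the solution sets viewed as
-- functions on ordered pairs of distinct vertices.)
SameSolutions : ∀ {n} → Graph n → Graph n → Set
SameSolutions G H = ∀ β → (IsNajiSolution G β → IsNajiSolution H β)
                        × (IsNajiSolution H β → IsNajiSolution G β)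

SameEdges : ∀ {n} → Graph n → Graph n → Set
SameEdges G H = ∀ v w → adj G v w ≡ adj H v w

Isomorphic : ∀ {n} → Graph n → Graph n → Set
Isomorphic {n} G H = Σ (Fin n ⤖ Fin n) λ f →
  ∀ v w → adj G v w ≡ adj H (Bijection.to f v) (Bijection.to f w)

-- The solutions of the Naji equations of H form a coset of the solutions of
-- the homogeneous system, which contains for every vertex v the switch δᵥ
-- (δᵥ(a,b) = [a = v] + [b = v]·[ab ∈ E(H)]).  For a non-edge vw of H one has
-- δᵥ(v,w) + δᵥ(w,v) = 1.  So if every solution of H solves G and vw ∈ E(G),
-- adding δᵥ to a solution of H would violate equation (a) of G at vw unless
-- vw ∈ E(H).  For (ii), the complete and the empty graph on two vertices
-- share the solution β(a,b) = [a < b].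
module Submission where

open import Defs renaming (sym to adj-sym)
open import Data.Nat using (ℕ)
open import Data.Product using (Σ; ∃; _×_; _,_; proj₁; proj₂)
open import Data.Fin using (Fin; zero; suc)
open import Data.Fin.Properties using (_≟_; _<?_; <-cmp; <-asym)
open import Data.Bool using (Bool; true; false; not; _∧_; _xor_)
open import Data.Bool.Properties
  using (xor-∧-commutativeRing; xor-same; xor-comm; xor-identityʳ; ∧-identityʳ; ∧-zeroʳ)
open import Algebra.Bundles using (CommutativeRing)
open import Relation.Binary.Definitions using (tri<; tri≈; tri>)
open import Relation.Nullary using (¬_; does; contradiction)
open import Relation.Nullary.Decidable using (dec-true; dec-false; does-⇔)
open import Function.Bundles using (mk⇔)
open import Relation.Binary.PropositionalEquality
  using (_≡_; _≢_; refl; sym; trans; cong; cong₂; ≢-sym; module ≡-Reasoning)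

open import Algebra.Properties.CommutativeSemigroup
  (CommutativeRing.+-commutativeSemigroup xor-∧-commutativeRing)
  using (interchange)

private
  variable
    n : ℕ

≡-from-⇔-true : {a b : Bool} → (a ≡ true → b ≡ true) → (b ≡ true → a ≡ true) → a ≡ b
≡-from-⇔-true {false} {false} _   _   = refl
≡-from-⇔-true {false} {true}  _   b⇒a = b⇒a refl
≡-from-⇔-true {true}          a⇒b _   = sym (a⇒b refl)

xor-interchange₄ : ∀ a b c d a′ b′ c′ d′ →
  (a xor a′) xor (b xor b′) xor (c xor c′) xor (d xor d′)
  ≡ (a xor b xor c xor d) xor (a′ xor b′ xor c′ xor d′)
xor-interchange₄ a b c d a′ b′ c′ d′ = begin
  (a xor a′) xor (b xor b′) xor (c xor c′) xor (d xor d′)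
    ≡⟨ cong (λ t → (a xor a′) xor (b xor b′) xor t) (interchange c c′ d d′) ⟩
  (a xor a′) xor (b xor b′) xor ((c xor d) xor (c′ xor d′))
    ≡⟨ cong ((a xor a′) xor_) (interchange b b′ (c xor d) (c′ xor d′)) ⟩
  (a xor a′) xor ((b xor c xor d) xor (b′ xor c′ xor d′))
    ≡⟨ interchange a a′ (b xor c xor d) (b′ xor c′ xor d′) ⟩
  (a xor b xor c xor d) xor (a′ xor b′ xor c′ xor d′) ∎
  where open ≡-Reasoning

adjacent⇒distinct : (G : Graph n) {v w : Fin n} → adj G v w ≡ true → v ≢ w
adjacent⇒distinct G {v} e refl = contradiction (trans (sym e) (irrefl G v)) λ ()

_⊕_ : Assignment n → Assignment n → Assignment n
(β ⊕ γ) a b = β a b xor γ a b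

record IsHomogeneousNajiSolution (G : Graph n) (δ : Assignment n) : Set where
  field
    eqA : ∀ v w → v ≢ w → adj G v w ≡ true →
          (δ v w xor δ w v) ≡ false
    eqB : ∀ v w x → v ≢ w → v ≢ x → w ≢ x →
          adj G v w ≡ true → adj G v x ≡ false → adj G w x ≡ false →
          (δ x v xor δ x w) ≡ false
    eqC : ∀ v w x → v ≢ w → v ≢ x → w ≢ x →
          adj G v w ≡ true → adj G v x ≡ true → adj G w x ≡ false →
          (δ v w xor δ v x xor δ w x xor δ x w) ≡ false

solution-⊕-homogeneous : {G : Graph n} {β δ : Assignment n} →
  IsNajiSolution G β → IsHomogeneousNajiSolution G δ → IsNajiSolution G (β ⊕ δ)
solution-⊕-homogeneous {β = β} {δ} sol hom = record
  { eqA = λ v w v≢w vw →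
      trans (interchange (β v w) (δ v w) (β w v) (δ w v))
            (cong₂ _xor_ (S.eqA v w v≢w vw) (H.eqA v w v≢w vw))
  ; eqB = λ v w x v≢w v≢x w≢x vw vx wx →
      trans (interchange (β x v) (δ x v) (β x w) (δ x w))
            (cong₂ _xor_ (S.eqB v w x v≢w v≢x w≢x vw vx wx)
                         (H.eqB v w x v≢w v≢x w≢x vw vx wx))
  ; eqC = λ v w x v≢w v≢x w≢x vw vx wx →
      trans (xor-interchange₄ (β v w) (β v x) (β w x) (β x w)
                              (δ v w) (δ v x) (δ w x) (δ x w))
            (cong₂ _xor_ (S.eqC v w x v≢w v≢x w≢x vw vx wx)
                         (H.eqC v w x v≢w v≢x w≢x vw vx wx))
  }
  where
  module S = IsNajiSolution sol
  module H = IsHomogeneousNajiSolution hom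

isAt : Fin n → Fin n → Bool
isAt v a = does (a ≟ v)

switch : Graph n → Fin n → Assignment n
switch H v a b = isAt v a xor (isAt v b ∧ adj H a b)

module _ (H : Graph n) (v : Fin n) where

  switch-adjacent : ∀ {a b} → adj H a b ≡ true →
    switch H v a b ≡ isAt v a xor isAt v b
  switch-adjacent {a} {b} e = begin
    isAt v a xor (isAt v b ∧ adj H a b) ≡⟨ cong (λ t → isAt v a xor (isAt v b ∧ t)) e ⟩
    isAt v a xor (isAt v b ∧ true)      ≡⟨ cong (isAt v a xor_) (∧-identityʳ (isAt v b)) ⟩
    isAt v a xor isAt v b               ∎
    where open ≡-Reasoning

  switch-nonadjacent : ∀ {a b} → adj H a b ≡ false → switch H v a b ≡ isAt v a
  switch-nonadjacent {a} {b} e = begin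
    isAt v a xor (isAt v b ∧ adj H a b) ≡⟨ cong (λ t → isAt v a xor (isAt v b ∧ t)) e ⟩
    isAt v a xor (isAt v b ∧ false)     ≡⟨ cong (isAt v a xor_) (∧-zeroʳ (isAt v b)) ⟩
    isAt v a xor false                  ≡⟨ xor-identityʳ (isAt v a) ⟩
    isAt v a                            ∎
    where open ≡-Reasoning

  switch-homogeneous : IsHomogeneousNajiSolution H (switch H v)
  switch-homogeneous = record
    { eqA = λ a b _ ab →
        trans (cong₂ _xor_ (switch-adjacent ab) (switch-adjacent (trans (adj-sym H b a) ab)))
              (pair-cancel (isAt v a) (isAt v b))
    ; eqB = λ a b x _ _ _ _ ax bx →
        trans (cong₂ _xor_ (switch-nonadjacent (trans (adj-sym H x a) ax))
                           (switch-nonadjacent (trans (adj-sym H x b) bx)))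
              (xor-same (isAt v x))
    ; eqC = λ a b x _ _ _ ab ax bx →
        trans (cong₂ _xor_ (switch-adjacent ab)
                (cong₂ _xor_ (switch-adjacent ax)
                  (cong₂ _xor_ (switch-nonadjacent bx)
                               (switch-nonadjacent (trans (adj-sym H x b) bx)))))
              (triple-cancel (isAt v a) (isAt v b) (isAt v x))
    }
    where
    pair-cancel : ∀ p q → (p xor q) xor (q xor p) ≡ false
    pair-cancel p q = trans (cong ((p xor q) xor_) (xor-comm q p)) (xor-same (p xor q))

    triple-cancel : ∀ p q r → (p xor q) xor (p xor r) xor q xor r ≡ false
    triple-cancel false false false = refl
    triple-cancel false false true  = refl
    triple-cancel false true  false = refl
    triple-cancel false true  true  = refl
    triple-cancel true  false false = refl
    triple-cancel true  false true  = refl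
    triple-cancel true  true  false = refl
    triple-cancel true  true  true  = refl

  switch-violates-nonedge : ∀ {w} → v ≢ w → adj H v w ≡ false →
    switch H v v w xor switch H v w v ≡ true
  switch-violates-nonedge {w} v≢w e = begin
    switch H v v w xor switch H v w v ≡⟨ cong₂ _xor_ (switch-nonadjacent e)
                                           (switch-nonadjacent (trans (adj-sym H w v) e)) ⟩
    isAt v v xor isAt v w             ≡⟨ cong₂ _xor_ (dec-true (v ≟ v) refl)
                                           (dec-false (w ≟ v) (≢-sym v≢w)) ⟩
    true xor false                    ∎
    where open ≡-Reasoning

edge-reflected : {G H : Graph n} → IsNaji H →
  (∀ β → IsNajiSolution H β → IsNajiSolution G β) →
  ∀ v w → adj G v w ≡ true → adj H v w ≡ true
edge-reflected {G = G} {H} (β , solH) H⊆G v w vw∈G with adj H v w in vw∉H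
... | true  = refl
... | false = contradiction true≡false λ ()
  where
  open ≡-Reasoning
  v≢w = adjacent⇒distinct G vw∈G
  β′  = β ⊕ switch H v
  solG  = H⊆G β solH
  solG′ = H⊆G β′ (solution-⊕-homogeneous solH (switch-homogeneous H v))

  true≡false : true ≡ false
  true≡false = begin
    true
      ≡⟨ sym (IsNajiSolution.eqA solG′ v w v≢w vw∈G) ⟩
    β′ v w xor β′ w v
      ≡⟨ interchange (β v w) (switch H v v w) (β w v) (switch H v w v) ⟩
    (β v w xor β w v) xor (switch H v v w xor switch H v w v)
      ≡⟨ cong₂ _xor_ (IsNajiSolution.eqA solG v w v≢w vw∈G)
                     (switch-violates-nonedge H v v≢w vw∉H) ⟩
    true xor true
      ∎

sameSolutions⇒sameEdges : (G H : Graph n) → IsNaji G → IsNaji H →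
  SameSolutions G H → SameEdges G H
sameSolutions⇒sameEdges G H najiG najiH same v w =
  ≡-from-⇔-true (edge-reflected najiH (λ β → proj₂ (same β)) v w)
                (edge-reflected najiG (λ β → proj₁ (same β)) v w)

complete : (n : ℕ) → Graph n
complete n = record
  { adj    = λ v w → not (does (v ≟ w))
  ; sym    = λ v w → cong not (does-⇔ (mk⇔ sym sym) (v ≟ w) (w ≟ v))
  ; irrefl = λ v → cong not (dec-true (v ≟ v) refl)
  }

empty : (n : ℕ) → Graph n
empty n = record { adj = λ _ _ → false ; sym = λ _ _ → refl ; irrefl = λ _ → refl }

complete-adjacent : {v w : Fin n} → v ≢ w → adj (complete n) v w ≡ true
complete-adjacent {v = v} {w} v≢w = cong not (dec-false (v ≟ w) v≢w)

precedes : Assignment n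
precedes a b = does (a <? b)

precedes-solves-complete : IsNajiSolution (complete n) precedes
precedes-solves-complete = record
  { eqA = λ v w v≢w _ → tournament v w v≢w
  ; eqB = λ v w x _ v≢x _ _ vx _ → nonadjacent-absurd v≢x vx
  ; eqC = λ v w x _ _ w≢x _ _ wx → nonadjacent-absurd w≢x wx
  }
  where
  nonadjacent-absurd : ∀ {A : Set} {v w : Fin n} → v ≢ w → adj (complete n) v w ≡ false → A
  nonadjacent-absurd v≢w e = contradiction (trans (sym (complete-adjacent v≢w)) e) λ ()

  tournament : ∀ v w → v ≢ w → does (v <? w) xor does (w <? v) ≡ true
  tournament v w v≢w with <-cmp v w
  ... | tri< v<w _ _ = cong₂ _xor_ (dec-true (v <? w) v<w) (dec-false (w <? v) (<-asym v<w))
  ... | tri≈ _ v≡w _ = contradiction v≡w v≢w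
  ... | tri> _ _ w<v = cong₂ _xor_ (dec-false (v <? w) (<-asym w<v)) (dec-true (w <? v) w<v)

all-solve-empty : (β : Assignment n) → IsNajiSolution (empty n) β
all-solve-empty β = record
  { eqA = λ { _ _ _ () }
  ; eqB = λ { _ _ _ _ _ _ () _ _ }
  ; eqC = λ { _ _ _ _ _ _ () _ _ }
  }

complete≇empty : ¬ Isomorphic (complete 2) (empty 2)
complete≇empty (_ , preserves) with () ← preserves zero (suc zero)

corollary9 :
    ((n : ℕ) (G H : Graph n) → IsNaji G → IsNaji H →
       SameSolutions G H → SameEdges G H)
    × (∃ λ (n : ℕ) → Σ (Graph n) λ G → Σ (Graph n) λ H →
         IsNaji G × IsNaji H × ¬ Isomorphic G H
         × (∃ λ β → IsNajiSolution G β × IsNajiSolution H β))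
corollary9 =
  (λ _ → sameSolutions⇒sameEdges) ,
  (2 , complete 2 , empty 2 ,
   (precedes , precedes-solves-complete) , (precedes , all-solve-empty precedes) ,
   complete≇empty ,
   precedes , precedes-solves-complete , all-solve-empty precedes)
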